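{- Let $G$ be a simple graph on $n$ vertices with an orientation, and let $\delta>0$. Suppose there is no edge oriented $u\to v$ with $\mathrm{disc}(v)-\mathrm{disc}(u)>\delta$ (i.e., the orientation is a local optimum of local search that flips an edge $u\to v$ whenever $\mathrm{disc}(v)-\mathrm{disc}(u)>\delta$). Then $\max_v|\mathrm{disc}(v)|=O(n^{1/3}\delta^{2/3})$.
   Context: For an orientation, $\mathrm{disc}(v)=|\delta_{\mathrm{in}}(v)|-|\delta_{\mathrm{out}}(v)|$ (in-degree minus out-degree).
   Formalization: The local-search threshold δ ranges over the positive rationals. -}

module Defs where

open import Data.Nat using (ℕ; zero; suc)
open import Data.Fin using (Fin)
open import Data.Bool using (Bool; true; false; if_then_else_)
open import Data.List using (List; map)
open import Data.Nat.ListAction using (sum)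
open import Data.List using (allFin) 
open import Data.Integer using (ℤ; +_; _-_; ∣_∣)
open import Data.Rational using (ℚ)
import Data.Rational as ℚ
open import Relation.Binary.PropositionalEquality using (_≡_; _≢_)
open import Data.Product using (_×_)
open import Data.Sum using (_⊎_)

record SimpleGraph (n : ℕ) : Set where
  field
    adj    : Fin n → Fin n → Bool
    sym    : ∀ u v → adj u v ≡ adj v u
    irrefl : ∀ v → adj v v ≡ false
open SimpleGraph public

record Orientation {n : ℕ} (G : SimpleGraph n) : Set where
  field
    arc      : Fin n → Fin n → Bool
    arc-edge : ∀ u v → arc u v ≡ true → adj G u v ≡ true
    edge-arc : ∀ u v → adj G u v ≡ true →
               (arc u v ≡ true × arc v u ≡ false) ⊎ (arc u v ≡ false × arc v u ≡ true)
open Orientation public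

count : {n : ℕ} → (Fin n → Bool) → ℕ
count {n} p = sum (map (λ w → if p w then 1 else 0) (allFin n))

inDeg : {n : ℕ} {G : SimpleGraph n} → Orientation G → Fin n → ℕ
inDeg O v = count (λ u → arc O u v)

outDeg : {n : ℕ} {G : SimpleGraph n} → Orientation G → Fin n → ℕ
outDeg O v = count (λ w → arc O v w)

disc : {n : ℕ} {G : SimpleGraph n} → Orientation G → Fin n → ℤ
disc O v = + inDeg O v - + outDeg O v

LocallyOptimal : {n : ℕ} {G : SimpleGraph n} → Orientation G → ℚ → Set
LocallyOptimal O δ = ∀ u v → arc O u v ≡ true →
  ℚ._≤_ (ℚ._/_ (disc O v - disc O u) 1) δ

-- Let d(v) = indeg v − outdeg v and a(s) = #{v | d(v) ≥ s}. Summing d over {d ≥ t} shows that t·a(t) is at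
-- most the number of arcs entering this set. Since discrepancies are integers we may take D = ⌊δ⌋, and local
-- optimality forces every such arc to run from the window [t − D, t) into [t, t + D); so t·a(t) ≤ Q·P for the
-- sizes Q, P of these windows. Hence Q ≥ t, and 4t·a(t + D) ≤ (P + Q)² by AM–GM. If some vertex has
-- discrepancy M = s + 2Di ≤ 2(s + D), peeling i windows of width 2D off {d ≥ s} therefore gives M·i² ≤ 8·a(s);
-- taking i ≈ M/4D and a(s) ≤ n yields M³ = O(n·D²). Negative discrepancies are handled by reversing all arcs.
module Submission where

open import Data.Bool using (Bool)
open import Data.Fin using (Fin)
open import Data.Nat using (ℕ)

module FiniteSums where

  open import Data.Bool using (Bool; true; false; T; not; _∧_; if_then_else_)
  open import Data.Fin using (Fin; zero; suc)
  open import Data.List using (allFin; map; tabulate)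
  open import Data.List.Properties using (map-tabulate)
  import Data.Nat.ListAction as List
  open import Data.Nat using (ℕ; zero; suc; _+_; _*_; _≤_; z≤n)
  open import Data.Nat.Properties using (+-*-semiring; +-mono-≤; *-monoʳ-≤; ≤-refl; ≤-trans; m≤m+n; m≤n+m; +-identityʳ)
  open import Data.Empty using (⊥-elim)
  open import Function using (_∘_; id)
  open import Relation.Binary.PropositionalEquality using (_≡_; refl; cong; trans; sym)
  open import Algebra.Properties.Semiring.Sum +-*-semiring public
    using (sum; sum-syntax; ∑-distrib-+; ∑-comm; *-distribˡ-sum; *-distribʳ-sum; sum-cong-≗)

  sum-mono-≤ : ∀ {n} {f g : Fin n → ℕ} → (∀ i → f i ≤ g i) → sum f ≤ sum g
  sum-mono-≤ {zero}  f≤g = z≤n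
  sum-mono-≤ {suc n} f≤g = +-mono-≤ (f≤g zero) (sum-mono-≤ (f≤g ∘ suc))

  sum-tabulate : ∀ {n} (f : Fin n → ℕ) → List.sum (tabulate f) ≡ sum f
  sum-tabulate {zero}  f = refl
  sum-tabulate {suc n} f = cong (f zero +_) (sum-tabulate (f ∘ suc))

  sum-map-allFin : ∀ {n} (f : Fin n → ℕ) → List.sum (map f (allFin n)) ≡ sum f
  sum-map-allFin f = trans (cong List.sum (map-tabulate id f)) (sum-tabulate f)

  ≤-sum : ∀ {n} (f : Fin n → ℕ) i → f i ≤ sum f
  ≤-sum f zero    = m≤m+n _ _
  ≤-sum f (suc i) = ≤-trans (≤-sum (f ∘ suc) i) (m≤n+m _ _)

  𝟙 : Bool → ℕ
  𝟙 b = if b then 1 else 0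

  𝟙≤1 : ∀ b → 𝟙 b ≤ 1
  𝟙≤1 false = z≤n
  𝟙≤1 true  = ≤-refl

  𝟙-mono : ∀ {b c} → (T b → T c) → 𝟙 b ≤ 𝟙 c
  𝟙-mono {false} b⇒c = z≤n
  𝟙-mono {true} {false} b⇒c = ⊥-elim (b⇒c _)
  𝟙-mono {true} {true}  b⇒c = ≤-refl

  𝟙-∧ : ∀ b c → 𝟙 (b ∧ c) ≡ 𝟙 b * 𝟙 c
  𝟙-∧ false c     = refl
  𝟙-∧ true  false = refl
  𝟙-∧ true  true  = refl

  𝟙-split : ∀ b c → 𝟙 c ≡ 𝟙 (b ∧ c) + 𝟙 (not b ∧ c)
  𝟙-split false c = refl
  𝟙-split true  c = sym (+-identityʳ (𝟙 c))

  𝟙-∧-not : ∀ {b c} → (T b → T c) → 𝟙 (c ∧ not b) + 𝟙 b ≡ 𝟙 c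
  𝟙-∧-not {false} {false} b⇒c = refl
  𝟙-∧-not {false} {true}  b⇒c = refl
  𝟙-∧-not {true}  {false} b⇒c = ⊥-elim (b⇒c _)
  𝟙-∧-not {true}  {true}  b⇒c = refl

  𝟙-*-mono : ∀ b {x y} → (T b → x ≤ y) → 𝟙 b * x ≤ 𝟙 b * y
  𝟙-*-mono false x≤y = z≤n
  𝟙-*-mono true  x≤y = *-monoʳ-≤ 1 (x≤y _)

  #_ : ∀ {n} → (Fin n → Bool) → ℕ
  #_ {n} p = ∑[ i < n ] 𝟙 (p i)

  #≤n : ∀ {n} (p : Fin n → Bool) → # p ≤ n
  #≤n {zero}  p = z≤n
  #≤n {suc n} p = +-mono-≤ (𝟙≤1 (p zero)) (#≤n (p ∘ suc))

  #-pos : ∀ {n} (p : Fin n → Bool) {i} → T (p i) → 1 ≤ # p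
  #-pos p {i} pᵢ = ≤-trans (𝟙-mono {true} (λ _ → pᵢ)) (≤-sum (𝟙 ∘ p) i)

module Peeling where

  open import Data.Nat
  open import Data.Nat.Properties
  open import Data.Nat.DivMod using (_/_; m≡m%n+[m/n]*n; m%n<n; m/n*n≤m)
  open import Data.Nat.Tactic.RingSolver using (solve-∀)
  open import Data.Product using (∃-syntax; _×_; _,_)
  open import Data.Sum using (inj₁; inj₂)
  open import Data.Empty using (⊥-elim)
  open import Relation.Binary.PropositionalEquality

  4*[m*n]≤[m+n]*[m+n] : ∀ m n → 4 * (m * n) ≤ (m + n) * (m + n)
  4*[m*n]≤[m+n]*[m+n] m n with ≤-total m n
  ... | inj₁ m≤n with k , refl ← m≤n⇒∃[o]m+o≡n m≤n =
    ≤-trans (m≤m+n _ (k * k)) (≤-reflexive (expand m k))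
    where
    expand : ∀ m k → 4 * (m * (m + k)) + k * k ≡ (m + (m + k)) * (m + (m + k))
    expand = solve-∀
  ... | inj₂ n≤m with k , refl ← m≤n⇒∃[o]m+o≡n n≤m =
    ≤-trans (m≤m+n _ (k * k)) (≤-reflexive (expand n k))
    where
    expand : ∀ n k → 4 * ((n + k) * n) + k * k ≡ (n + k + n) * (n + k + n)
    expand = solve-∀

  m*m≤n*n⇒m≤n : ∀ {m n} → m * m ≤ n * n → m ≤ n
  m*m≤n*n⇒m≤n m*m≤n*n = ≮⇒≥ (λ n<m → <⇒≱ (*-mono-< n<m n<m) m*m≤n*n)

  [1+m]*[1+m]≤2+2*[m*m] : ∀ m → suc m * suc m ≤ 2 + 2 * (m * m)
  [1+m]*[1+m]≤2+2*[m*m] zero    = m≤m+n 1 1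
  [1+m]*[1+m]≤2+2*[m*m] (suc m) = ≤-trans (m≤m+n _ (m * m)) (≤-reflexive (expand m))
    where
    expand : ∀ m → suc (suc m) * suc (suc m) + m * m ≡ 2 + 2 * (suc m * suc m)
    expand = solve-∀

  -- a s is the number of vertices of discrepancy ≥ s, and y counts those in the window [s, s + 2D).
  StepBound : (ℕ → ℕ) → ℕ → ℕ → Set
  StepBound a D s = ∃[ y ] a (s + D + D) + y ≤ a s × s + D ≤ y × 4 * ((s + D) * a (s + D + D)) ≤ y * y

  Steps : (ℕ → ℕ) → ℕ → ℕ → Set
  Steps a D M = ∀ s → s + D ≤ M → StepBound a D s

  growth-step : ∀ {a D M s} i → StepBound a D s → M ≤ 2 * (s + D) →
                M * (i * i) ≤ 8 * a (s + D + D) → M * (suc i * suc i) ≤ 8 * a s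
  growth-step {a} {D} {M} {s} i (y , shrink , s+D≤y , 4ta≤y*y) M≤2[s+D] IH = begin
      M * (suc i * suc i)             ≡⟨ expand M i ⟩
      M * (i * i) + 2 * (M * i) + M   ≤⟨ +-mono-≤ (+-mono-≤ IH (*-monoʳ-≤ 2 Mi≤2y)) M≤2y ⟩
      8 * a s′ + 2 * (2 * y) + 2 * y  ≡⟨ collect (a s′) y ⟩
      8 * a s′ + 6 * y                ≤⟨ +-monoʳ-≤ (8 * a s′) (*-monoˡ-≤ y (m≤m+n 6 2)) ⟩
      8 * a s′ + 8 * y                ≡⟨ *-distribˡ-+ 8 (a s′) y ⟨
      8 * (a s′ + y)                  ≤⟨ *-monoʳ-≤ 8 shrink ⟩
      8 * a s                         ∎
    where
    open ≤-Reasoning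
    s′ = s + D + D
    M≤2y : M ≤ 2 * y
    M≤2y = ≤-trans M≤2[s+D] (*-monoʳ-≤ 2 s+D≤y)
    Mi≤2y : M * i ≤ 2 * y
    Mi≤2y = m*m≤n*n⇒m≤n (begin
      M * i * (M * i)              ≡⟨ regroup M i ⟩
      M * (M * (i * i))            ≤⟨ *-mono-≤ M≤2[s+D] IH ⟩
      2 * (s + D) * (8 * a s′)     ≡⟨ regroup′ (s + D) (a s′) ⟩
      4 * (4 * ((s + D) * a s′))   ≤⟨ *-monoʳ-≤ 4 4ta≤y*y ⟩
      4 * (y * y)                  ≡⟨ regroup″ y ⟩
      2 * y * (2 * y)              ∎)
      where
      regroup : ∀ M i → M * i * (M * i) ≡ M * (M * (i * i))
      regroup = solve-∀
      regroup′ : ∀ t b → 2 * t * (8 * b) ≡ 4 * (4 * (t * b))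
      regroup′ = solve-∀
      regroup″ : ∀ y → 4 * (y * y) ≡ 2 * y * (2 * y)
      regroup″ = solve-∀
    expand : ∀ M i → M * (suc i * suc i) ≡ M * (i * i) + 2 * (M * i) + M
    expand = solve-∀
    collect : ∀ b y → 8 * b + 2 * (2 * y) + 2 * y ≡ 8 * b + 6 * y
    collect = solve-∀

  growth : ∀ {a D M} → Steps a D M → ∀ i s → s + i * (D + D) ≡ M → M ≤ 2 * (s + D) → M * (i * i) ≤ 8 * a s
  growth {M = M} steps zero s _ _ = ≤-trans (≤-reflexive (*-zeroʳ M)) z≤n
  growth {a} {D} {M} steps (suc i) s s+[1+i]2D≡M M≤2[s+D] =
    growth-step {a} {D} {M} {s} i (steps s s+D≤M) M≤2[s+D] (growth steps i (s + D + D) s′+i2D≡M M≤2[s′+D])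
    where
    s+D≤M : s + D ≤ M
    s+D≤M = ≤-trans (+-monoʳ-≤ s (≤-trans (m≤m+n D D) (m≤m+n (D + D) _))) (≤-reflexive s+[1+i]2D≡M)
    s′+i2D≡M : s + D + D + i * (D + D) ≡ M
    s′+i2D≡M = trans (shift s D i) s+[1+i]2D≡M
      where
      shift : ∀ s D i → s + D + D + i * (D + D) ≡ s + suc i * (D + D)
      shift = solve-∀
    M≤2[s′+D] : M ≤ 2 * (s + D + D + D)
    M≤2[s′+D] = ≤-trans M≤2[s+D] (*-monoʳ-≤ 2 (≤-trans (m≤m+n (s + D) D) (m≤m+n _ D)))

  growth-without-slack : ∀ {a M} n → Steps a 0 M → (∀ s → a s ≤ n) → M ≡ 0
  growth-without-slack {M = zero}  n steps a≤n = refl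
  growth-without-slack {M = suc m} n steps a≤n = ⊥-elim (<⇒≱ 8n<M[1+8n]² M[1+8n]²≤8n)
    where
    k = suc (8 * n)
    M[1+8n]²≤8n : suc m * (k * k) ≤ 8 * n
    M[1+8n]²≤8n = ≤-trans (growth steps k (suc m) (trans (cong (suc m +_) (*-zeroʳ k)) (+-identityʳ (suc m)))
                                                    (≤-trans (m≤m+n (suc m) 0) (m≤m+n _ _)))
                          (*-monoʳ-≤ 8 (a≤n (suc m)))
    8n<M[1+8n]² : 8 * n < suc m * (k * k)
    8n<M[1+8n]² = ≤-trans (m≤m*n k k) (m≤n*m (k * k) (suc m))

  growth-with-slack : ∀ {a d M} n → Steps a (suc d) M → (∀ s → a s ≤ n) → M ≤ n →
                      let I = M / (4 * suc d) in M * (suc I * suc I) ≤ 18 * n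
  growth-with-slack {d = d} {M} n steps a≤n M≤n = begin
      M * (suc I * suc I)            ≤⟨ *-monoʳ-≤ M ([1+m]*[1+m]≤2+2*[m*m] I) ⟩
      M * (2 + 2 * (I * I))          ≡⟨ distrib M I ⟩
      2 * M + 2 * (M * (I * I))      ≤⟨ +-mono-≤ (*-monoʳ-≤ 2 M≤n) (*-monoʳ-≤ 2 MI²≤8n) ⟩
      2 * n + 2 * (8 * n)            ≡⟨ collect n ⟩
      18 * n                         ∎
    where
    open ≤-Reasoning
    D = suc d
    I = M / (4 * D)
    I2D≤M : I * (D + D) ≤ M
    I2D≤M = ≤-trans (m≤m+n _ _) (≤-trans (≤-reflexive (double I D)) (m/n*n≤m M (4 * D)))
      where
      double : ∀ I D → I * (D + D) + I * (D + D) ≡ I * (4 * D)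
      double = solve-∀
    s = M ∸ I * (D + D)
    s+I2D≡M : s + I * (D + D) ≡ M
    s+I2D≡M = m∸n+n≡m I2D≤M
    M≤2s : M ≤ 2 * s
    M≤2s = +-cancelʳ-≤ (I * (4 * D)) M (2 * s) (begin
      M + I * (4 * D)                      ≤⟨ +-monoʳ-≤ M (m/n*n≤m M (4 * D)) ⟩
      M + M                                ≡⟨ cong (λ x → x + x) s+I2D≡M ⟨
      s + I * (D + D) + (s + I * (D + D))  ≡⟨ twice s I D ⟩
      2 * s + I * (4 * D)                  ∎)
      where
      twice : ∀ s I D → s + I * (D + D) + (s + I * (D + D)) ≡ 2 * s + I * (4 * D)
      twice = solve-∀
    MI²≤8n : M * (I * I) ≤ 8 * n
    MI²≤8n = ≤-trans (growth steps I s s+I2D≡M (≤-trans M≤2s (*-monoʳ-≤ 2 (m≤m+n s D))))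
                     (*-monoʳ-≤ 8 (a≤n s))
    distrib : ∀ M I → M * (2 + 2 * (I * I)) ≡ 2 * M + 2 * (M * (I * I))
    distrib = solve-∀
    collect : ∀ n → 2 * n + 2 * (8 * n) ≡ 18 * n
    collect = solve-∀

  cube-bound : ∀ {a D M} n → Steps a D M → (∀ s → a s ≤ n) → M ≤ n → M * M * M ≤ 288 * n * (D * D)
  cube-bound {D = zero} n steps a≤n M≤n rewrite growth-without-slack n steps a≤n = z≤n
  cube-bound {D = D@(suc _)} {M} n steps a≤n M≤n = begin
      M * M * M                              ≡⟨ *-assoc M M M ⟩
      M * (M * M)                            ≤⟨ *-monoʳ-≤ M (*-mono-≤ M≤[1+I]K M≤[1+I]K) ⟩
      M * (suc I * K * (suc I * K))          ≡⟨ regroup M I D ⟩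
      M * (suc I * suc I) * (16 * (D * D))   ≤⟨ *-monoˡ-≤ (16 * (D * D)) (growth-with-slack n steps a≤n M≤n) ⟩
      18 * n * (16 * (D * D))                ≡⟨ regroup′ n D ⟩
      288 * n * (D * D)                      ∎
    where
    open ≤-Reasoning
    K = 4 * D
    I = M / K
    M≤[1+I]K : M ≤ suc I * K
    M≤[1+I]K = ≤-trans (≤-reflexive (m≡m%n+[m/n]*n M K)) (<⇒≤ (+-monoˡ-< (I * K) (m%n<n M K)))
    regroup : ∀ M I D → M * (suc I * (4 * D) * (suc I * (4 * D))) ≡ M * (suc I * suc I) * (16 * (D * D))
    regroup = solve-∀
    regroup′ : ∀ n D → 18 * n * (16 * (D * D)) ≡ 288 * n * (D * D)
    regroup′ = solve-∀

module Digraph {n : ℕ} (arc : Fin n → Fin n → Bool) where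

  open import Data.Bool using (Bool; true; false; T; not; _∧_)
  open import Data.Bool.Properties using (T-∧)
  open import Data.Nat
  open import Data.Nat.Properties
  open import Data.Nat.Tactic.RingSolver using (solve-∀)
  open import Data.Product using (_×_; _,_)
  open import Function using (_∘_; Equivalence)
  open import Relation.Binary.PropositionalEquality
  open import Relation.Nullary using (¬_)
  open import Relation.Nullary.Decidable using (⌊_⌋; toWitness; fromWitness; toWitnessFalse; fromWitnessFalse)
  open FiniteSums
  open Peeling using (StepBound; 4*[m*n]≤[m+n]*[m+n]; cube-bound)

  indeg outdeg : Fin n → ℕ
  indeg v = # λ u → arc u v
  outdeg u = # arc u

  arcs : (Fin n → Bool) → (Fin n → Bool) → ℕ
  arcs p q = ∑[ v < n ] ∑[ u < n ] 𝟙 (p u ∧ (q v ∧ arc u v))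

  indeg-sum : ∀ A → ∑[ v < n ] (𝟙 (A v) * indeg v) ≡ arcs A A + arcs (not ∘ A) A
  indeg-sum A = begin
    ∑[ v < n ] (𝟙 (A v) * indeg v)                             ≡⟨ sum-cong-≗ in-split ⟩
    ∑[ v < n ] (∑[ u < n ] inside v u + ∑[ u < n ] outside v u)  ≡⟨ ∑-distrib-+ (λ v → ∑[ u < n ] inside v u) _ ⟩
    arcs A A + arcs (not ∘ A) A                                ∎
    where
    open ≡-Reasoning
    inside outside : Fin n → Fin n → ℕ
    inside  v u = 𝟙 (A u ∧ (A v ∧ arc u v))
    outside v u = 𝟙 (not (A u) ∧ (A v ∧ arc u v))
    in-split : ∀ v → 𝟙 (A v) * indeg v ≡ ∑[ u < n ] inside v u + ∑[ u < n ] outside v u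
    in-split v = begin
      𝟙 (A v) * indeg v                          ≡⟨ *-distribˡ-sum (𝟙 (A v)) (λ u → 𝟙 (arc u v)) ⟩
      ∑[ u < n ] (𝟙 (A v) * 𝟙 (arc u v))          ≡⟨ sum-cong-≗ (λ u → trans (sym (𝟙-∧ (A v) (arc u v))) (𝟙-split (A u) _)) ⟩
      ∑[ u < n ] (inside v u + outside v u)        ≡⟨ ∑-distrib-+ (inside v) (outside v) ⟩
      ∑[ u < n ] inside v u + ∑[ u < n ] outside v u ∎

  arcs≤outdeg-sum : ∀ p q → arcs p q ≤ ∑[ u < n ] (𝟙 (p u) * outdeg u)
  arcs≤outdeg-sum p q = begin
    arcs p q                                         ≡⟨ ∑-comm (λ v u → 𝟙 (p u ∧ (q v ∧ arc u v))) ⟩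
    ∑[ u < n ] ∑[ v < n ] 𝟙 (p u ∧ (q v ∧ arc u v))  ≤⟨ sum-mono-≤ (λ u → sum-mono-≤ (forget-q u)) ⟩
    ∑[ u < n ] ∑[ v < n ] 𝟙 (p u ∧ arc u v)          ≡⟨ sum-cong-≗ out-split ⟨
    ∑[ u < n ] (𝟙 (p u) * outdeg u)                  ∎
    where
    open ≤-Reasoning
    forget-q : ∀ u v → 𝟙 (p u ∧ (q v ∧ arc u v)) ≤ 𝟙 (p u ∧ arc u v)
    forget-q u v with p u | q v
    ... | false | _     = z≤n
    ... | true  | false = z≤n
    ... | true  | true  = ≤-refl
    out-split : ∀ u → 𝟙 (p u) * outdeg u ≡ ∑[ v < n ] 𝟙 (p u ∧ arc u v)
    out-split u = trans (*-distribˡ-sum (𝟙 (p u)) (𝟙 ∘ arc u)) (sum-cong-≗ (λ v → sym (𝟙-∧ (p u) (arc u v))))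

  cut-lower-bound : ∀ t A → (∀ v → T (A v) → t + outdeg v ≤ indeg v) → t * # A ≤ arcs (not ∘ A) A
  cut-lower-bound t A surplus = +-cancelˡ-≤ (arcs A A) _ _ (begin
    arcs A A + t * # A                                        ≤⟨ +-monoˡ-≤ (t * # A) (arcs≤outdeg-sum A A) ⟩
    ∑[ v < n ] (𝟙 (A v) * outdeg v) + t * # A                 ≡⟨ cong (∑[ v < n ] (𝟙 (A v) * outdeg v) +_) t*#A ⟩
    ∑[ v < n ] (𝟙 (A v) * outdeg v) + ∑[ v < n ] (𝟙 (A v) * t) ≡⟨ ∑-distrib-+ (λ v → 𝟙 (A v) * outdeg v) _ ⟨
    ∑[ v < n ] (𝟙 (A v) * outdeg v + 𝟙 (A v) * t)             ≤⟨ sum-mono-≤ pointwise ⟩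
    ∑[ v < n ] (𝟙 (A v) * indeg v)                            ≡⟨ indeg-sum A ⟩
    arcs A A + arcs (not ∘ A) A                               ∎)
    where
    open ≤-Reasoning
    t*#A : t * # A ≡ ∑[ v < n ] (𝟙 (A v) * t)
    t*#A = trans (*-comm t (# A)) (*-distribʳ-sum t (𝟙 ∘ A))
    pointwise : ∀ v → 𝟙 (A v) * outdeg v + 𝟙 (A v) * t ≤ 𝟙 (A v) * indeg v
    pointwise v = ≤-trans (≤-reflexive (sym (*-distribˡ-+ (𝟙 (A v)) (outdeg v) t)))
                          (𝟙-*-mono (A v) (λ Aᵥ → ≤-trans (≤-reflexive (+-comm (outdeg v) t)) (surplus v Aᵥ)))

  arcs≤#*# : ∀ {p q p′ q′} → (∀ {u v} → T (arc u v) → T (p u) → T (q v) → T (p′ u) × T (q′ v)) →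
             arcs p q ≤ # p′ * # q′
  arcs≤#*# {p} {q} {p′} {q′} confined = begin
    arcs p q                                   ≤⟨ sum-mono-≤ (λ v → sum-mono-≤ (pointwise v)) ⟩
    ∑[ v < n ] ∑[ u < n ] (𝟙 (q′ v) * 𝟙 (p′ u)) ≡⟨ sum-cong-≗ (λ v → *-distribˡ-sum (𝟙 (q′ v)) (𝟙 ∘ p′)) ⟨
    ∑[ v < n ] (𝟙 (q′ v) * # p′)               ≡⟨ *-distribʳ-sum (# p′) (𝟙 ∘ q′) ⟨
    # q′ * # p′                                ≡⟨ *-comm (# q′) (# p′) ⟩
    # p′ * # q′                                ∎
    where
    open ≤-Reasoning
    pointwise : ∀ v u → 𝟙 (p u ∧ (q v ∧ arc u v)) ≤ 𝟙 (q′ v) * 𝟙 (p′ u)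
    pointwise v u = ≤-trans (𝟙-mono restrict) (≤-reflexive (𝟙-∧ (q′ v) (p′ u)))
      where
      restrict : T (p u ∧ (q v ∧ arc u v)) → T (q′ v ∧ p′ u)
      restrict h with pᵤ , qᵥ∧u→v ← Equivalence.to (T-∧ {p u}) h
                 with qᵥ , u→v ← Equivalence.to (T-∧ {q v}) qᵥ∧u→v
                 with p′ᵤ , q′ᵥ ← confined u→v pᵤ qᵥ
        = Equivalence.from (T-∧ {q′ v}) (q′ᵥ , p′ᵤ)

  atLeast : ℕ → Fin n → Bool
  atLeast s v = ⌊ s + outdeg v ≤? indeg v ⌋

  between : ℕ → ℕ → Fin n → Bool
  between s t v = atLeast s v ∧ not (atLeast t v)

  ∈between : ∀ {s t v} → T (atLeast s v) → T (not (atLeast t v)) → T (between s t v)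
  ∈between {s} {t} {v} v≥s v≱t = Equivalence.from (T-∧ {atLeast s v}) (v≥s , v≱t)

  atLeast-anti : ∀ {s t v} → s ≤ t → T (atLeast t v) → T (atLeast s v)
  atLeast-anti s≤t v∈ = fromWitness (≤-trans (+-monoˡ-≤ _ s≤t) (toWitness v∈))

  #between+#atLeast : ∀ {s t} → s ≤ t → # between s t + # atLeast t ≡ # atLeast s
  #between+#atLeast {s} {t} s≤t =
    trans (sym (∑-distrib-+ (𝟙 ∘ between s t) (𝟙 ∘ atLeast t)))
          (sum-cong-≗ (λ v → 𝟙-∧-not (atLeast-anti {v = v} s≤t)))

  LocallyOptimalℕ : ℕ → Set
  LocallyOptimalℕ D = ∀ {u v} → T (arc u v) → indeg v + outdeg u ≤ indeg u + outdeg v + D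

  crossing-arc-window : ∀ s D {iu ou iv ov} → s + D + ov ≤ iv → ¬ (s + D + ou ≤ iu) → iv + ou ≤ iu + ov + D →
                        s + ou ≤ iu × ¬ (s + D + D + ov ≤ iv)
  crossing-arc-window s D {iu} {ou} {iv} {ov} v∈ u∉ gap =
      +-cancelʳ-≤ (D + ov) (s + ou) iu (begin
        s + ou + (D + ov)  ≡⟨ swap₁ s ou D ov ⟩
        s + D + ov + ou    ≤⟨ +-monoˡ-≤ ou v∈ ⟩
        iv + ou            ≤⟨ gap ⟩
        iu + ov + D        ≡⟨ swap₂ iu ov D ⟩
        iu + (D + ov)      ∎)
    , λ v∈′ → <⇒≱ (+-cancelʳ-≤ ou (suc iv) (s + D + D + ov) (begin
        suc iv + ou        ≤⟨ s≤s gap ⟩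
        suc iu + ov + D    ≤⟨ +-monoˡ-≤ D (+-monoˡ-≤ ov (≰⇒> u∉)) ⟩
        s + D + ou + ov + D ≡⟨ swap₃ s D ou ov ⟩
        s + D + D + ov + ou ∎)) v∈′
    where
    open ≤-Reasoning
    swap₁ : ∀ s ou D ov → s + ou + (D + ov) ≡ s + D + ov + ou
    swap₁ = solve-∀
    swap₂ : ∀ iu ov D → iu + ov + D ≡ iu + (D + ov)
    swap₂ = solve-∀
    swap₃ : ∀ s D ou ov → s + D + ou + ov + D ≡ s + D + D + ov + ou
    swap₃ = solve-∀

  module _ {D : ℕ} (optimal : LocallyOptimalℕ D) where

    cut≤#*# : ∀ s → arcs (not ∘ atLeast (s + D)) (atLeast (s + D)) ≤ # between s (s + D) * # between (s + D) (s + D + D)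
    cut≤#*# s = arcs≤#*# λ {u} {v} u→v u∉ v∈ →
      let s≤dᵤ , dᵥ<s+2D = crossing-arc-window s D (toWitness v∈) (toWitnessFalse u∉) (optimal u→v)
      in ∈between {s} {s + D} {u} (fromWitness s≤dᵤ) u∉ , ∈between {s + D} {s + D + D} {v} v∈ (fromWitnessFalse dᵥ<s+2D)

    step : ∀ s → 1 ≤ # atLeast (s + D) → StepBound (λ r → # atLeast r) D s
    step s nonempty = Q + P , shrink , t≤Q+P , 4ta≤[Q+P]²
      where
      open ≤-Reasoning
      a : ℕ → ℕ
      a r = # atLeast r
      t = s + D
      Q = # between s t
      P = # between t (t + D)
      instance
        a[t]≢0 : NonZero (a t)
        a[t]≢0 = >-nonZero nonempty
      P+a[t+D]≡a[t] : P + a (t + D) ≡ a t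
      P+a[t+D]≡a[t] = #between+#atLeast (m≤m+n t D)
      shrink : a (t + D) + (Q + P) ≤ a s
      shrink = ≤-reflexive (begin-equality
        a (t + D) + (Q + P)  ≡⟨ +-comm (a (t + D)) (Q + P) ⟩
        Q + P + a (t + D)    ≡⟨ +-assoc Q P (a (t + D)) ⟩
        Q + (P + a (t + D))  ≡⟨ cong (Q +_) P+a[t+D]≡a[t] ⟩
        Q + a t              ≡⟨ #between+#atLeast (m≤m+n s D) ⟩
        a s                  ∎)
      ta≤QP : t * a t ≤ Q * P
      ta≤QP = ≤-trans (cut-lower-bound t (atLeast t) (λ v → toWitness)) (cut≤#*# s)
      t≤Q+P : t ≤ Q + P
      t≤Q+P = ≤-trans (*-cancelʳ-≤ t Q (a t) (begin
        t * a t  ≤⟨ ta≤QP ⟩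
        Q * P    ≤⟨ *-monoʳ-≤ Q (≤-trans (m≤m+n P _) (≤-reflexive P+a[t+D]≡a[t])) ⟩
        Q * a t  ∎)) (m≤m+n Q P)
      4ta≤[Q+P]² : 4 * (t * a (t + D)) ≤ (Q + P) * (Q + P)
      4ta≤[Q+P]² = begin
        4 * (t * a (t + D))  ≤⟨ *-monoʳ-≤ 4 (*-monoʳ-≤ t (≤-trans (m≤n+m _ P) (≤-reflexive P+a[t+D]≡a[t]))) ⟩
        4 * (t * a t)        ≤⟨ *-monoʳ-≤ 4 ta≤QP ⟩
        4 * (Q * P)          ≤⟨ 4*[m*n]≤[m+n]*[m+n] Q P ⟩
        (Q + P) * (Q + P)    ∎

    vertex-cube-bound : ∀ {M v} → M + outdeg v ≤ indeg v → M * M * M ≤ 288 * n * (D * D)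
    vertex-cube-bound {M} {v} M+out≤in = cube-bound {a = λ r → # atLeast r} n steps (λ _ → #≤n _) M≤n
      where
      M≤n : M ≤ n
      M≤n = ≤-trans (m≤m+n M (outdeg v)) (≤-trans M+out≤in (#≤n _))
      steps : ∀ s → s + D ≤ M → StepBound (λ r → # atLeast r) D s
      steps s s+D≤M = step s (#-pos (atLeast (s + D)) (fromWitness (≤-trans (+-monoˡ-≤ (outdeg v) s+D≤M) M+out≤in)))

module Integers where

  open import Data.Integer using (+_; _-_; _+_; ∣_∣; _≤_; 0ℤ)
  open import Data.Integer.Properties using (pos-+; i≤j⇒i-j≤0; i-j≤0⇒i≤j; drop‿+≤+; m-n≡m⊖n; ≤-⊖; ∣⊖∣-≤)
  import Data.Integer.Properties as ℤ
  open import Data.Integer.Tactic.RingSolver using (solve-∀)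
  import Data.Nat as ℕ
  import Data.Nat.Properties as ℕ
  open import Data.Sum using (_⊎_; inj₁; inj₂)
  open import Relation.Binary.PropositionalEquality

  [a-b]-[c-e]≤d⇒a+e≤c+b+d : ∀ a b c e d → (+ a - + b) - (+ c - + e) ≤ + d → a ℕ.+ e ℕ.≤ c ℕ.+ b ℕ.+ d
  [a-b]-[c-e]≤d⇒a+e≤c+b+d a b c e d gap = drop‿+≤+ (i-j≤0⇒i≤j (begin
    + (a ℕ.+ e) - + (c ℕ.+ b ℕ.+ d)    ≡⟨ cong₂ _-_ (pos-+ a e) (trans (pos-+ (c ℕ.+ b) d) (cong (_+ + d) (pos-+ c b))) ⟩
    (+ a + + e) - (+ c + + b + + d)    ≡⟨ regroup (+ a) (+ b) (+ c) (+ e) (+ d) ⟩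
    (+ a - + b) - (+ c - + e) - + d    ≤⟨ i≤j⇒i-j≤0 gap ⟩
    0ℤ                                 ∎))
    where
    open ℤ.≤-Reasoning
    regroup : ∀ a b c e d → (a + e) - (c + b + d) ≡ (a - b) - (c - e) - d
    regroup = solve-∀

  ∣m-n∣+n≤m⊎∣m-n∣+m≤n : ∀ m n → ∣ + m - + n ∣ ℕ.+ n ℕ.≤ m ⊎ ∣ + m - + n ∣ ℕ.+ m ℕ.≤ n
  ∣m-n∣+n≤m⊎∣m-n∣+m≤n m n rewrite m-n≡m⊖n m n with ℕ.≤-total n m
  ... | inj₁ n≤m = inj₁ (ℕ.≤-reflexive (trans (cong (λ k → ∣ k ∣ ℕ.+ n) (≤-⊖ n≤m)) (ℕ.m∸n+n≡m n≤m)))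
  ... | inj₂ m≤n = inj₂ (ℕ.≤-reflexive (trans (cong (ℕ._+ m) (∣⊖∣-≤ m≤n)) (ℕ.m∸n+n≡m m≤n)))

module Rationals where

  open import Data.Integer as ℤ using (+_; -[1+_])
  import Data.Integer.Properties as ℤ
  open import Data.Nat as ℕ using (ℕ; suc)
  import Data.Nat.Properties as ℕ
  open import Data.Nat.DivMod using (m/n*n≤m; m*n/n≡m; /-monoˡ-≤)
  open import Data.Nat.Coprimality using (1-coprimeTo)
  import Data.Nat.Coprimality as Coprime
  open import Data.Nat.GCD using (gcd-zeroʳ)
  open import Data.Rational
  open import Data.Rational.Properties
  import Data.Rational.Unnormalised as ℚᵘ
  import Data.Rational.Unnormalised.Properties as ℚᵘ
  open import Data.Product using (∃-syntax; _×_; _,_)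
  open import Relation.Binary.PropositionalEquality

  ⟦_⟧ : ℕ → ℚ
  ⟦ k ⟧ = + k / 1

  ↥-/1 : ∀ i → ↥ (i / 1) ≡ i
  ↥-/1 i = trans (sym (ℤ.*-identityʳ _)) (trans (cong (↥ (i / 1) ℤ.*_) (cong +_ (sym (gcd-zeroʳ ℤ.∣ i ∣)))) (↥-/ i 1))

  ↧-/1 : ∀ i → ↧ (i / 1) ≡ + 1
  ↧-/1 i = trans (sym (ℤ.*-identityʳ _)) (trans (cong (↧ (i / 1) ℤ.*_) (cong +_ (sym (gcd-zeroʳ ℤ.∣ i ∣)))) (↧-/ i 1))

  ⟦⟧≡mkℚ : ∀ k → ⟦ k ⟧ ≡ mkℚ (+ k) 0 (Coprime.sym (1-coprimeTo k))
  ⟦⟧≡mkℚ k = normalize-coprime _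

  ⟦⟧-nonNeg : ∀ k → NonNegative ⟦ k ⟧
  ⟦⟧-nonNeg k = normalize-nonNeg k 1

  ⟦⟧-mono-≤ : ∀ {m k} → m ℕ.≤ k → ⟦ m ⟧ ≤ ⟦ k ⟧
  ⟦⟧-mono-≤ {m} {k} m≤k rewrite ⟦⟧≡mkℚ m | ⟦⟧≡mkℚ k = *≤* (ℤ.*-monoʳ-≤-nonNeg (+ 1) (ℤ.+≤+ m≤k))

  ⟦⟧-* : ∀ m k → ⟦ m ⟧ * ⟦ k ⟧ ≡ ⟦ m ℕ.* k ⟧
  ⟦⟧-* m k = toℚᵘ-injective (ℚᵘ.≃-trans (toℚᵘ-homo-* ⟦ m ⟧ ⟦ k ⟧) (ℚᵘ.≃-reflexive (begin
    toℚᵘ ⟦ m ⟧ ℚᵘ.* toℚᵘ ⟦ k ⟧  ≡⟨ cong₂ (λ p q → toℚᵘ p ℚᵘ.* toℚᵘ q) (⟦⟧≡mkℚ m) (⟦⟧≡mkℚ k) ⟩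
    ℚᵘ.mkℚᵘ (+ m ℤ.* + k) 0    ≡⟨ cong (λ i → ℚᵘ.mkℚᵘ i 0) (ℤ.pos-* m k) ⟨
    ℚᵘ.mkℚᵘ (+ (m ℕ.* k)) 0    ≡⟨ cong toℚᵘ (⟦⟧≡mkℚ (m ℕ.* k)) ⟨
    toℚᵘ ⟦ m ℕ.* k ⟧            ∎)))
    where open ≡-Reasoning

  integer-part : ∀ δ → 0ℚ < δ → ∃[ d ] ⟦ d ⟧ ≤ δ × (∀ i → i / 1 ≤ δ → i ℤ.≤ + d)
  integer-part (mkℚ -[1+ _ ] _ _) (*<* ())
  integer-part (mkℚ (+ p) q-1 _) _ = p ℕ./ q , ⟦d⟧≤δ , below
    where
    q = suc q-1
    ⟦d⟧≤δ : ⟦ p ℕ./ q ⟧ ≤ mkℚ (+ p) q-1 _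
    ⟦d⟧≤δ rewrite ⟦⟧≡mkℚ (p ℕ./ q) = *≤* (subst₂ ℤ._≤_ (ℤ.pos-* (p ℕ./ q) q) (sym (ℤ.*-identityʳ (+ p))) (ℤ.+≤+ (m/n*n≤m p q)))
    below : ∀ i → i / 1 ≤ mkℚ (+ p) q-1 _ → i ℤ.≤ + (p ℕ./ q)
    below i i≤δ with i | subst₂ ℤ._≤_ (cong (ℤ._* + q) (↥-/1 i)) (cong (+ p ℤ.*_) (↧-/1 i)) (drop-*≤* i≤δ)
    ... | -[1+ _ ] | _    = ℤ.-≤+
    ... | + m      | mq≤p = ℤ.+≤+ (ℕ.≤-trans (ℕ.≤-reflexive (sym (m*n/n≡m m q))) (/-monoˡ-≤ q
                              (ℤ.drop‿+≤+ (subst₂ ℤ._≤_ (sym (ℤ.pos-* m q)) (ℤ.*-identityʳ (+ p)) mq≤p))))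

  ⟦⟧-cube-bound : ∀ {m c k d δ} → m ℕ.* m ℕ.* m ℕ.≤ c ℕ.* k ℕ.* (d ℕ.* d) → ⟦ d ⟧ ≤ δ →
                  ⟦ m ⟧ * ⟦ m ⟧ * ⟦ m ⟧ ≤ ⟦ c ⟧ * ⟦ k ⟧ * (δ * δ)
  ⟦⟧-cube-bound {m} {c} {k} {d} {δ} m³≤ckd² d≤δ = begin
    ⟦ m ⟧ * ⟦ m ⟧ * ⟦ m ⟧             ≡⟨ trans (cong (_* ⟦ m ⟧) (⟦⟧-* m m)) (⟦⟧-* (m ℕ.* m) m) ⟩
    ⟦ m ℕ.* m ℕ.* m ⟧                 ≤⟨ ⟦⟧-mono-≤ m³≤ckd² ⟩
    ⟦ c ℕ.* k ℕ.* (d ℕ.* d) ⟧         ≡⟨ trans (cong₂ _*_ (⟦⟧-* c k) (⟦⟧-* d d)) (⟦⟧-* (c ℕ.* k) (d ℕ.* d)) ⟨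
    ⟦ c ⟧ * ⟦ k ⟧ * (⟦ d ⟧ * ⟦ d ⟧)   ≤⟨ *-monoˡ-≤-nonNeg (⟦ c ⟧ * ⟦ k ⟧) {{ck≥0}} d²≤δ² ⟩
    ⟦ c ⟧ * ⟦ k ⟧ * (δ * δ)           ∎
    where
    open ≤-Reasoning
    ck≥0 = nonNeg*nonNeg⇒nonNeg ⟦ c ⟧ {{⟦⟧-nonNeg c}} ⟦ k ⟧ {{⟦⟧-nonNeg k}}
    δ≥0 = nonNegative (≤-trans (nonNegative⁻¹ ⟦ d ⟧ {{⟦⟧-nonNeg d}}) d≤δ)
    d²≤δ² : ⟦ d ⟧ * ⟦ d ⟧ ≤ δ * δ
    d²≤δ² = ≤-trans (*-monoˡ-≤-nonNeg ⟦ d ⟧ {{⟦⟧-nonNeg d}} d≤δ) (*-monoʳ-≤-nonNeg δ {{δ≥0}} d≤δ)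

module Discrepancy {n : ℕ} (arc : Fin n → Fin n → Bool) where

  open import Data.Integer using (+_; _-_; ∣_∣)
  open import Data.Nat using (_+_; _*_; _≤_)
  open import Data.Nat.Properties using (+-comm)
  open import Data.Sum using (inj₁; inj₂)
  open import Function using (flip)
  open import Relation.Binary.PropositionalEquality using (cong; subst₂)
  open Digraph using (indeg; outdeg; LocallyOptimalℕ; vertex-cube-bound)
  open Integers using (∣m-n∣+n≤m⊎∣m-n∣+m≤n)

  reverse-optimal : ∀ {d} → LocallyOptimalℕ arc d → LocallyOptimalℕ (flip arc) d
  reverse-optimal {d} optimal {u} {v} v→u =
    subst₂ _≤_ (+-comm (indeg arc u) (outdeg arc v)) (cong (_+ d) (+-comm (indeg arc v) (outdeg arc u))) (optimal v→u)

  ∣in-out∣-cube-bound : ∀ {d} → LocallyOptimalℕ arc d → ∀ v →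
                        ∣ + indeg arc v - + outdeg arc v ∣ * ∣ + indeg arc v - + outdeg arc v ∣ * ∣ + indeg arc v - + outdeg arc v ∣
                          ≤ 288 * n * (d * d)
  ∣in-out∣-cube-bound optimal v with ∣m-n∣+n≤m⊎∣m-n∣+m≤n (indeg arc v) (outdeg arc v)
  ... | inj₁ surplus = vertex-cube-bound arc optimal surplus
  ... | inj₂ deficit = vertex-cube-bound (flip arc) (reverse-optimal optimal) deficit

open import Defs hiding (sym)
open import Data.Product using (Σ; _,_)
open import Data.Integer using (∣_∣; +_)
open import Data.Rational using (ℚ; 0ℚ; _<_; _≤_; _*_; _/_)
import Data.Integer as ℤ
import Data.Nat as ℕ
open import Data.Bool.Properties using (T-≡)
open import Function using (_∘_; Equivalence)
open import Relation.Binary.PropositionalEquality using (_≡_; cong₂; subst)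
open FiniteSums using (𝟙; sum-map-allFin)
open Digraph using (indeg; outdeg; LocallyOptimalℕ)
open Integers using ([a-b]-[c-e]≤d⇒a+e≤c+b+d)
open Rationals using (integer-part; ⟦⟧-cube-bound)
open Discrepancy using (∣in-out∣-cube-bound)

module _ {n} {G : SimpleGraph n} (O : Orientation G) where

  disc≡in-out : ∀ v → disc O v ≡ + indeg (arc O) v ℤ.- + outdeg (arc O) v
  disc≡in-out v = cong₂ (λ i o → + i ℤ.- + o) (sum-map-allFin (λ u → 𝟙 (arc O u v))) (sum-map-allFin (𝟙 ∘ arc O v))

  locally-optimal-ℕ : ∀ {δ d} → (∀ i → i / 1 ≤ δ → i ℤ.≤ + d) → LocallyOptimal O δ → LocallyOptimalℕ (arc O) d
  locally-optimal-ℕ {d = d} below optimal {u} {v} u→v =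
    [a-b]-[c-e]≤d⇒a+e≤c+b+d (indeg (arc O) v) (outdeg (arc O) v) (indeg (arc O) u) (outdeg (arc O) u) d
      (subst (ℤ._≤ + d) (cong₂ ℤ._-_ (disc≡in-out v) (disc≡in-out u))
             (below _ (optimal u v (Equivalence.to T-≡ u→v))))

  ∣disc∣-cube-bound : ∀ {d} → LocallyOptimalℕ (arc O) d → ∀ v →
                      ∣ disc O v ∣ ℕ.* ∣ disc O v ∣ ℕ.* ∣ disc O v ∣ ℕ.≤ 288 ℕ.* n ℕ.* (d ℕ.* d)
  ∣disc∣-cube-bound optimal v rewrite disc≡in-out v = ∣in-out∣-cube-bound (arc O) optimal v

lemma5p2 : Σ ℕ λ C → ∀ (n : ℕ) (G : SimpleGraph n) (O : Orientation G) (δ : ℚ) →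
    0ℚ < δ → LocallyOptimal O δ → ∀ (v : Fin n) →
      ((+ ∣ disc O v ∣) / 1) * ((+ ∣ disc O v ∣) / 1) * ((+ ∣ disc O v ∣) / 1)
        ≤ ((+ C) / 1) * ((+ n) / 1) * (δ * δ)
lemma5p2 = 288 , λ n G O δ 0<δ optimal v →
  let d , d≤δ , below = integer-part δ 0<δ
  in ⟦⟧-cube-bound {∣ disc O v ∣} {288} {n} {d} (∣disc∣-cube-bound O (locally-optimal-ℕ O below optimal) v) d≤δ
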